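{- Let $k \in \mathbb{Z}_{\ge 0}$, let $n \in \mathbb{Z}_{\ge 1}$, and let $b_n \in \{0,1,2\}$ with $n \equiv b_n \pmod 3$. If $n > 24k + 12 - 8b_n$, then every set $A$ with $|A| = d_n - k$ that works for $n$ is strongly $n$-bounded, i.e., satisfies $A \subset (n/4, n/2)$.
   Context: A numerical semigroup is a subset of $\mathbb{Z}_{\ge 0}$ containing $0$ and closed under addition; $\langle A\rangle$ denotes the numerical semigroup generated by $A$. A set $A \subset \mathbb{Z}_{\ge 1}$ works for $n$ if (i) $n \notin \langle A \rangle$, (ii) $x < n/2$ for all $x \in A$, and (iii) $A$ minimally generates a numerical semigroup, i.e., $\langle A \setminus \{x\}\rangle \neq \langle A \rangle$ for every $x \in A$. Here $d_n = |(n/3, n/2) \cap \mathbb{Z}| = \lfloor (n-1)/2 \rfloor - \lfloor n/3 \rfloor$. -}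

module Defs where

open import Data.Nat using (ℕ; zero; suc; _+_; _*_; _∸_; _<_; _≤_)
open import Data.Nat.DivMod using (_/_; _%_)
open import Data.List using (List; length)
open import Data.List.Membership.Propositional using (_∈_)
open import Data.List.Relation.Unary.Unique.Propositional using (Unique)
open import Data.Product using (_×_)
open import Relation.Binary.PropositionalEquality using (_≢_)
open import Relation.Nullary using (¬_)
open import Function.Bundles using (_⇔_)

data ⟨_⟩ (G : ℕ → Set) : ℕ → Set where
  zero∈ : ⟨ G ⟩ 0
  add∈  : ∀ {a m} → G a → ⟨ G ⟩ m → ⟨ G ⟩ (a + m)

-- A finite set of naturals is represented by a duplicate-free list.
Mem : List ℕ → ℕ → Set
Mem A x = x ∈ A

Remove : List ℕ → ℕ → ℕ → Set
Remove A x y = (y ∈ A) × (y ≢ x)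

MinimallyGenerates : List ℕ → Set
MinimallyGenerates A =
  ∀ x → x ∈ A → ¬ (∀ m → (⟨ Remove A x ⟩ m ⇔ ⟨ Mem A ⟩ m))

Works : ℕ → List ℕ → Set
Works n A =
  Unique A
  × (∀ x → x ∈ A → 1 ≤ x)
  × ¬ (⟨ Mem A ⟩ n)
  × (∀ x → x ∈ A → 2 * x < n)
  × MinimallyGenerates A

-- d_n = ⌊(n-1)/2⌋ - ⌊n/3⌋  (nonnegative for n ≥ 1)
d : ℕ → ℕ
d n = ((n ∸ 1) / 2) ∸ (n / 3)

StronglyBounded : ℕ → List ℕ → Set
StronglyBounded n A = ∀ x → x ∈ A → (n < 4 * x) × (2 * x < n)

module Submission where

-- Let A work for n and suppose some x ∈ A had 4x ≤ n.  We show
-- that the 2|A| numbers  a  and  n - a  (a ∈ A), together with n/2 when n is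
-- even, have pairwise distinct residues modulo x:
--   * a ≡ b with a < b would make b = a + cx redundant as a generator;
--   * n - a ≡ n - b reduces to b ≡ a;
--   * a ≡ n - b, or n/2 ≡ a, makes n congruent to a sum s < n of two elements
--     of A, so n = s + cx ∈ ⟨A⟩;  n/2 ≡ n - a reduces to n/2 ≡ a.
-- By pigeonhole 2|A| + [n even] ≤ x, hence 4(2|A| + [n even]) ≤ n.  Writing
-- |A| = d_n - k, this inequality is exactly the negation of n > 24k+12-8b_n.

open import Defs
open import Data.Nat using (ℕ; _+_; _*_; _<_; _≤_)
open import Data.Nat.DivMod using (_%_)
open import Data.List using (List; length)
open import Relation.Binary.PropositionalEquality using (_≡_)

open import Data.Nat using (zero; suc; _∸_; z≤n; s≤s; _≟_; _≤?_; NonZero; >-nonZero)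
open import Data.Nat.Properties
open import Data.Nat.DivMod using (_/_; _mod_; m≡m%n+[m/n]*n; m%n<n)
open import Data.Nat.Tactic.RingSolver using (solve-∀)
open import Data.Fin using (toℕ)
import Data.Fin as Fin
open import Data.Fin.Properties using (pigeonhole; toℕ-fromℕ<)
open import Data.List using (_++_; map; lookup)
open import Data.List.Properties using (length-++; length-map)
open import Data.List.Membership.Propositional using (_∈_)
open import Data.List.Membership.Propositional.Properties using (∈-lookup; ∈-length; ∈-map⁻; ∈-++⁻)
open import Data.List.Relation.Unary.Any using (here; there)
open import Data.List.Relation.Unary.All as All using (All)
import Data.List.Relation.Unary.All.Properties as All
open import Data.List.Relation.Unary.AllPairs using (AllPairs; []; _∷_)
import Data.List.Relation.Unary.AllPairs.Properties as AllPairs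
open import Data.List.Relation.Unary.Unique.Propositional using (Unique)
open import Data.Product using (_,_; ∃; ∃₂; proj₁)
open import Data.Sum using (_⊎_; inj₁; inj₂)
open import Relation.Nullary using (¬_; yes; no; contradiction)
open import Relation.Binary.PropositionalEquality
  using (refl; sym; trans; cong; cong₂; subst; _≢_; ≢-sym; module ≡-Reasoning)
open import Function.Bundles using (mk⇔)
open import Algebra.Properties.CommutativeSemigroup +-commutativeSemigroup
  using (interchange; x∙yz≈y∙xz)

module _ {G : ℕ → Set} where

  ⟨⟩-+ : ∀ {m m′} → ⟨ G ⟩ m → ⟨ G ⟩ m′ → ⟨ G ⟩ (m + m′)
  ⟨⟩-+ zero∈ q = q
  ⟨⟩-+ (add∈ {a} {m} g p) q = subst ⟨ G ⟩ (sym (+-assoc a m _)) (add∈ g (⟨⟩-+ p q))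

  ⟨⟩-multiple : ∀ {a} → G a → ∀ c → ⟨ G ⟩ (c * a)
  ⟨⟩-multiple g zero = zero∈
  ⟨⟩-multiple g (suc c) = add∈ g (⟨⟩-multiple g c)

  ⟨⟩-generator : ∀ {a} → G a → ⟨ G ⟩ a
  ⟨⟩-generator {a} g = subst ⟨ G ⟩ (+-identityʳ a) (add∈ g zero∈)

⟨⟩-mono : ∀ {G H : ℕ → Set} → (∀ {y} → G y → H y) → ∀ {m} → ⟨ G ⟩ m → ⟨ H ⟩ m
⟨⟩-mono f zero∈ = zero∈
⟨⟩-mono f (add∈ g p) = add∈ (f g) (⟨⟩-mono f p)

-- In a minimal generating set no generator a is generated by the others:
-- otherwise ⟨ A ∖ {a} ⟩ would already contain all of ⟨ A ⟩.
generator-not-redundant : ∀ {A a} → MinimallyGenerates A → a ∈ A → ¬ ⟨ Remove A a ⟩ a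
generator-not-redundant {A} {a} minimal a∈A a∈⟨A∖a⟩ =
  minimal a a∈A (λ m → mk⇔ (⟨⟩-mono proj₁) from)
  where
  from : ∀ {m} → ⟨ Mem A ⟩ m → ⟨ Remove A a ⟩ m
  from zero∈ = zero∈
  from (add∈ {b} b∈A p) with b ≟ a
  ... | yes refl = ⟨⟩-+ a∈⟨A∖a⟩ (from p)
  ... | no b≢a = add∈ (b∈A , b≢a) (from p)

infix 4 _≋_[mod_]
_≋_[mod_] : ℕ → ℕ → ℕ → Set
a ≋ b [mod X ] = ∃₂ λ i j → a + i * X ≡ b + j * X

module _ {X : ℕ} where

  ≋-refl : ∀ a → a ≋ a [mod X ]
  ≋-refl a = 0 , 0 , refl

  ≋-sym : ∀ {a b} → a ≋ b [mod X ] → b ≋ a [mod X ]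
  ≋-sym (i , j , e) = j , i , sym e

  ≋-cast : ∀ {a a′ b b′} → a ≡ a′ → b ≡ b′ → a ≋ b [mod X ] → a′ ≋ b′ [mod X ]
  ≋-cast refl refl a≋b = a≋b

  ≋-+ : ∀ {a b c d} → a ≋ b [mod X ] → c ≋ d [mod X ] → a + c ≋ b + d [mod X ]
  ≋-+ {a} {b} {c} {d} (i , j , e) (i′ , j′ , e′) = i + i′ , j + j′ , (begin
    (a + c) + (i + i′) * X       ≡⟨ cong ((a + c) +_) (*-distribʳ-+ X i i′) ⟩
    (a + c) + (i * X + i′ * X)   ≡⟨ interchange a c (i * X) (i′ * X) ⟩
    (a + i * X) + (c + i′ * X)   ≡⟨ cong₂ _+_ e e′ ⟩
    (b + j * X) + (d + j′ * X)   ≡⟨ interchange b (j * X) d (j′ * X) ⟩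
    (b + d) + (j * X + j′ * X)   ≡⟨ cong ((b + d) +_) (*-distribʳ-+ X j j′) ⟨
    (b + d) + (j + j′) * X       ∎)
    where open ≡-Reasoning

  ≋-cancelˡ : ∀ {a b c} → c + a ≋ c + b [mod X ] → a ≋ b [mod X ]
  ≋-cancelˡ {a} {b} {c} (i , j , e) =
    i , j , +-cancelˡ-≡ c _ _ (trans (sym (+-assoc c a (i * X))) (trans e (+-assoc c b (j * X))))

  ≋-split : ∀ {a b} → a ≋ b [mod X ] → (∃ λ c → b ≡ a + c * X) ⊎ (∃ λ c → a ≡ b + c * X)
  ≋-split (i , j , e) = split i j e
    where
    split : ∀ {a b} i j → a + i * X ≡ b + j * X →
            (∃ λ c → b ≡ a + c * X) ⊎ (∃ λ c → a ≡ b + c * X)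
    split {a} zero j e = inj₂ (j , trans (sym (+-identityʳ a)) e)
    split {a} {b} (suc i) zero e = inj₁ (suc i , trans (sym (+-identityʳ b)) (sym e))
    split {a} {b} (suc i) (suc j) e = split i j (+-cancelˡ-≡ X _ _ (begin
      X + (a + i * X) ≡⟨ x∙yz≈y∙xz X a (i * X) ⟩
      a + suc i * X   ≡⟨ e ⟩
      b + suc j * X   ≡⟨ x∙yz≈y∙xz b X (j * X) ⟩
      X + (b + j * X) ∎))
      where open ≡-Reasoning

  %⇒≋ : .{{_ : NonZero X}} → ∀ {a b} → a % X ≡ b % X → a ≋ b [mod X ]
  %⇒≋ {a} {b} e = b / X , a / X , (begin
    a + (b / X) * X                   ≡⟨ cong (_+ (b / X) * X) (m≡m%n+[m/n]*n a X) ⟩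
    (a % X + (a / X) * X) + (b / X) * X ≡⟨ cong (λ r → (r + (a / X) * X) + (b / X) * X) e ⟩
    (b % X + (a / X) * X) + (b / X) * X ≡⟨ +-assoc (b % X) _ _ ⟩
    b % X + ((a / X) * X + (b / X) * X) ≡⟨ cong (b % X +_) (+-comm ((a / X) * X) _) ⟩
    b % X + ((b / X) * X + (a / X) * X) ≡⟨ sym (+-assoc (b % X) _ _) ⟩
    (b % X + (b / X) * X) + (a / X) * X ≡⟨ cong (_+ (a / X) * X) (sym (m≡m%n+[m/n]*n b X)) ⟩
    b + (a / X) * X                   ∎)
    where open ≡-Reasoning

DistinctMod : (X : ℕ) .{{_ : NonZero X}} → ℕ → ℕ → Set
DistinctMod X a b = a % X ≢ b % X

AllPairs-lookup : ∀ {R : ℕ → ℕ → Set} {xs : List ℕ} → AllPairs R xs →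
                  ∀ {i j} → i Fin.< j → R (lookup xs i) (lookup xs j)
AllPairs-lookup (rx ∷ _) {Fin.zero} {Fin.suc j} _ = All.lookup rx (∈-lookup j)
AllPairs-lookup (_ ∷ rxs) {Fin.suc i} {Fin.suc j} (s≤s i<j) = AllPairs-lookup rxs i<j

distinct-residues-bound : ∀ X .{{_ : NonZero X}} {xs : List ℕ} →
                          AllPairs (DistinctMod X) xs → length xs ≤ X
distinct-residues-bound X {xs} distinct = ≮⇒≥ λ X<length →
  let (i , j , i<j , same-residue) = pigeonhole X<length (λ i → lookup xs i mod X)
  in AllPairs-lookup distinct i<j (begin
       lookup xs i % X        ≡⟨ sym (toℕ-fromℕ< _) ⟩
       toℕ (lookup xs i mod X) ≡⟨ cong toℕ same-residue ⟩
       toℕ (lookup xs j mod X) ≡⟨ toℕ-fromℕ< _ ⟩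
       lookup xs j % X        ∎)
  where open ≡-Reasoning

Unique⇒AllPairs : ∀ {R : ℕ → ℕ → Set} {xs : List ℕ} → Unique xs →
                  (∀ {a b} → a ∈ xs → b ∈ xs → a ≢ b → R a b) → AllPairs R xs
Unique⇒AllPairs [] _ = []
Unique⇒AllPairs (x∉xs ∷ unique) r =
  All.tabulate (λ b∈ → r (here refl) (there b∈) (All.lookup x∉xs b∈))
  ∷ Unique⇒AllPairs unique (λ a∈ b∈ → r (there a∈) (there b∈))

module WorkingSet {n : ℕ} {A : List ℕ}
  (A-unique : Unique A) (positive : ∀ a → a ∈ A → 1 ≤ a) (n∉⟨A⟩ : ¬ ⟨ Mem A ⟩ n)
  (below-half : ∀ a → a ∈ A → 2 * a < n) (minimal : MinimallyGenerates A)
  {x : ℕ} (x∈A : x ∈ A) where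

  instance
    x-nonZero : NonZero x
    x-nonZero = >-nonZero (positive x x∈A)

  n-positive : 1 ≤ n
  n-positive = ≤-trans (s≤s z≤n) (below-half x x∈A)

  element≤n : ∀ {a} → a ∈ A → a ≤ n
  element≤n {a} a∈A = <⇒≤ (≤-<-trans (m≤m+n a _) (below-half a a∈A))

  sum<n : ∀ {a b} → a ∈ A → b ∈ A → a + b < n
  sum<n {a} {b} a∈A b∈A = *-cancelˡ-< 2 (a + b) n (begin-strict
    2 * (a + b)   ≡⟨ *-distribˡ-+ 2 a b ⟩
    2 * a + 2 * b <⟨ +-mono-< (below-half a a∈A) (below-half b b∈A) ⟩
    n + n         ≡⟨ cong (n +_) (+-identityʳ n) ⟨
    2 * n         ∎)
    where open ≤-Reasoning

  -- n is not congruent to a sum s of two elements: n = s + cx would put n in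
  -- ⟨ A ⟩, and s = n + cx is impossible as s < n.
  sum≉n : ∀ {a b} → a ∈ A → b ∈ A → ¬ (a + b ≋ n [mod x ])
  sum≉n a∈A b∈A s≋n with ≋-split s≋n
  ... | inj₁ (c , n≡s+cx) =
    n∉⟨A⟩ (subst ⟨ Mem A ⟩ (sym n≡s+cx)
      (⟨⟩-+ (⟨⟩-+ (⟨⟩-generator a∈A) (⟨⟩-generator b∈A)) (⟨⟩-multiple x∈A c)))
  ... | inj₂ (c , s≡n+cx) = <⇒≱ (sum<n a∈A b∈A) (subst (n ≤_) (sym s≡n+cx) (m≤m+n n _))

  -- An element b ≠ a of A is never a + cx: for c > 0 it would be generated by
  -- a and x, both different from b.
  not-above : ∀ {a b} → a ∈ A → b ∈ A → a ≢ b → ∀ c → b ≢ a + c * x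
  not-above {a} a∈A b∈A a≢b zero b≡a+0 = a≢b (sym (trans b≡a+0 (+-identityʳ a)))
  not-above {a} {b} a∈A b∈A a≢b (suc c) b≡ =
    generator-not-redundant minimal b∈A (subst ⟨ Remove A b ⟩ (sym b≡)
      (⟨⟩-+ (⟨⟩-generator (a∈A , a≢b)) (⟨⟩-multiple (x∈A , x≢b) (suc c))))
    where
    x≢b : x ≢ b
    x≢b = <⇒≢ (subst (x <_) (sym b≡) (+-mono-≤ (positive a a∈A) (m≤m+n x (c * x))))

  distinct-elements : ∀ {a b} → a ∈ A → b ∈ A → a ≢ b → ¬ (a ≋ b [mod x ])
  distinct-elements a∈A b∈A a≢b a≋b with ≋-split a≋b
  ... | inj₁ (c , b≡) = not-above a∈A b∈A a≢b c b≡
  ... | inj₂ (c , a≡) = not-above b∈A a∈A (≢-sym a≢b) c a≡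

  complement-+ : ∀ {a} → a ∈ A → ∀ b → (n ∸ a) + (a + b) ≡ n + b
  complement-+ {a} a∈A b = trans (sym (+-assoc (n ∸ a) a b)) (cong (_+ b) (m∸n+n≡m (element≤n a∈A)))

  -- Adding a + b to n - a ≋ n - b gives n + b ≋ n + a.
  distinct-complements : ∀ {a b} → a ∈ A → b ∈ A → a ≢ b → ¬ (n ∸ a ≋ n ∸ b [mod x ])
  distinct-complements {a} {b} a∈A b∈A a≢b c≋c =
    distinct-elements b∈A a∈A (≢-sym a≢b) (≋-cancelˡ (≋-cast
      (complement-+ a∈A b) (trans (cong ((n ∸ b) +_) (+-comm a b)) (complement-+ b∈A a))
      (≋-+ c≋c (≋-refl (a + b)))))

  -- Adding b to a ≋ n - b gives a + b ≋ n.
  element≉complement : ∀ {a b} → a ∈ A → b ∈ A → ¬ (a ≋ n ∸ b [mod x ])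
  element≉complement a∈A b∈A a≋c =
    sum≉n a∈A b∈A (≋-cast refl (m∸n+n≡m (element≤n b∈A)) (≋-+ a≋c (≋-refl _)))

  module Half {h : ℕ} (h+h≡n : h + h ≡ n) where

    -- Doubling h ≋ a gives n ≋ a + a.
    half≉element : ∀ {a} → a ∈ A → ¬ (h ≋ a [mod x ])
    half≉element a∈A h≋a = sum≉n a∈A a∈A (≋-sym (≋-cast h+h≡n refl (≋-+ h≋a h≋a)))

    -- Adding a to h ≋ n - a gives h + a ≋ h + h.
    half≉complement : ∀ {a} → a ∈ A → ¬ (h ≋ n ∸ a [mod x ])
    half≉complement a∈A h≋c = half≉element a∈A (≋-sym (≋-cancelˡ (≋-cast refl
      (trans (m∸n+n≡m (element≤n a∈A)) (sym h+h≡n)) (≋-+ h≋c (≋-refl _)))))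

  separated : ∀ {a b} → ¬ (a ≋ b [mod x ]) → DistinctMod x a b
  separated a≉b same = a≉b (%⇒≋ same)

  elements-and-complements : List ℕ
  elements-and-complements = A ++ map (n ∸_) A

  elements-and-complements-distinct : AllPairs (DistinctMod x) elements-and-complements
  elements-and-complements-distinct = AllPairs.++⁺
    (Unique⇒AllPairs A-unique λ a∈ b∈ a≢b → separated (distinct-elements a∈ b∈ a≢b))
    (AllPairs.map⁺ (Unique⇒AllPairs A-unique λ a∈ b∈ a≢b → separated (distinct-complements a∈ b∈ a≢b)))
    (All.tabulate λ a∈ → All.map⁺ (All.tabulate λ b∈ → separated (element≉complement a∈ b∈)))

  half-distinct : ∀ {h} → h + h ≡ n → All (DistinctMod x h) elements-and-complements
  half-distinct {h} h+h≡n = All.tabulate λ v∈ → case-split (∈-++⁻ A v∈)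
    where
    open Half {h} h+h≡n
    case-split : ∀ {v} → v ∈ A ⊎ v ∈ map (n ∸_) A → DistinctMod x h v
    case-split (inj₁ a∈A) = separated (half≉element a∈A)
    case-split (inj₂ c∈) with ∈-map⁻ (n ∸_) c∈
    ... | a , a∈A , refl = separated (half≉complement a∈A)

  length-elements-and-complements : length elements-and-complements ≡ 2 * length A
  length-elements-and-complements = begin
    length (A ++ map (n ∸_) A)          ≡⟨ length-++ A ⟩
    length A + length (map (n ∸_) A)    ≡⟨ cong (length A +_) (length-map (n ∸_) A) ⟩
    length A + length A                 ≡⟨ cong (length A +_) (+-identityʳ (length A)) ⟨
    2 * length A                        ∎
    where open ≡-Reasoning

  -- Pigeonhole on the separated residues (with h = n/2 added when n is even): 2|A| + [n even] ≤ x.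
  residue-bound : 2 * length A + (n ∸ 1) % 2 ≤ x
  residue-bound with (n ∸ 1) % 2 | m%n<n (n ∸ 1) 2 | m≡m%n+[m/n]*n (n ∸ 1) 2
  ... | 0 | _ | _ =
    subst (_≤ x) (trans length-elements-and-complements (sym (+-identityʳ _)))
      (distinct-residues-bound x elements-and-complements-distinct)
  ... | 1 | _ | n-1≡1+2D =
    subst (_≤ x) (trans (cong suc length-elements-and-complements) (+-comm 1 _))
      (distinct-residues-bound x (half-distinct {suc D} h+h≡n ∷ elements-and-complements-distinct))
    where
    D = (n ∸ 1) / 2
    h+h≡n : suc D + suc D ≡ n
    h+h≡n = begin
      suc D + suc D       ≡⟨ suc-double D ⟩
      (1 + D * 2) + 1     ≡⟨ cong (_+ 1) n-1≡1+2D ⟨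
      (n ∸ 1) + 1         ≡⟨ m∸n+n≡m n-positive ⟩
      n                   ∎
      where
      open ≡-Reasoning
      suc-double : ∀ D → suc D + suc D ≡ (1 + D * 2) + 1
      suc-double = solve-∀
  ... | suc (suc _) | s≤s (s≤s ()) | _

count-identity : ∀ {n} k m e b T → n ≡ suc (e + ((m + k) + T) * 2) → n ≡ b + T * 3 →
                 (n + 8 * b) + 3 * n ≡ (24 * k + 12) + 3 * (4 * (2 * m + e))
count-identity {n} k m e b T n≡odd n≡b+3T = +-cancelʳ-≡ (24 * T) _ _ (begin
  (n + 8 * b) + 3 * n + 24 * T                   ≡⟨ regroup n b T ⟩
  4 * n + 8 * (b + T * 3)                        ≡⟨ cong (λ z → 4 * n + 8 * z) n≡b+3T ⟨
  4 * n + 8 * n                                  ≡⟨ four+eight n ⟩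
  12 * n                                         ≡⟨ cong (12 *_) n≡odd ⟩
  12 * suc (e + ((m + k) + T) * 2)               ≡⟨ expand k m e T ⟩
  (24 * k + 12) + 3 * (4 * (2 * m + e)) + 24 * T ∎)
  where
  open ≡-Reasoning
  regroup : ∀ n b T → (n + 8 * b) + 3 * n + 24 * T ≡ 4 * n + 8 * (b + T * 3)
  regroup = solve-∀
  four+eight : ∀ n → 4 * n + 8 * n ≡ 12 * n
  four+eight = solve-∀
  expand : ∀ k m e T → 12 * suc (e + ((m + k) + T) * 2) ≡ (24 * k + 12) + 3 * (4 * (2 * m + e)) + 24 * T
  expand = solve-∀

-- Write n - 1 = e + 2D and n = b + 3T, so that d n = D - T.  If m = d n - k ≥ 1
-- and 4(2m + e) ≤ n, the identity above yields n + 8b ≤ 24k + 12.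
residue-bound⇒small : ∀ n k m → 1 ≤ n → 1 ≤ m → m + k ≡ d n →
                      4 * (2 * m + (n ∸ 1) % 2) ≤ n → n + 8 * (n % 3) ≤ 24 * k + 12
residue-bound⇒small n k m 1≤n 1≤m m+k≡d bound = +-cancelʳ-≤ (3 * n) _ _
  (≤-trans (≤-reflexive (count-identity k m e b T n≡1+e+2[m+k+T] n≡b+3T))
           (+-monoʳ-≤ (24 * k + 12) (*-monoʳ-≤ 3 bound)))
  where
  D = (n ∸ 1) / 2
  e = (n ∸ 1) % 2
  T = n / 3
  b = n % 3

  -- m ≥ 1 forces d n = D - T to be a true difference.
  T≤D : T ≤ D
  T≤D with T ≤? D
  ... | yes T≤D = T≤D
  ... | no T≰D = contradiction (≤-trans 1≤m (≤-trans (m≤m+n m k)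
                   (≤-reflexive (trans m+k≡d (m≤n⇒m∸n≡0 (<⇒≤ (≰⇒> T≰D))))))) λ ()

  n≡1+e+2[m+k+T] : n ≡ suc (e + ((m + k) + T) * 2)
  n≡1+e+2[m+k+T] = begin
    n                            ≡⟨ m∸n+n≡m 1≤n ⟨
    (n ∸ 1) + 1                  ≡⟨ cong (_+ 1) (m≡m%n+[m/n]*n (n ∸ 1) 2) ⟩
    (e + D * 2) + 1              ≡⟨ +-comm _ 1 ⟩
    suc (e + D * 2)              ≡⟨ cong (λ z → suc (e + z * 2)) (m∸n+n≡m T≤D) ⟨
    suc (e + (D ∸ T + T) * 2)    ≡⟨ cong (λ z → suc (e + (z + T) * 2)) m+k≡d ⟨
    suc (e + ((m + k) + T) * 2)  ∎
    where open ≡-Reasoning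

  n≡b+3T : n ≡ b + T * 3
  n≡b+3T = m≡m%n+[m/n]*n n 3

theorem16 : (k n : ℕ) → 1 ≤ n →
    24 * k + 12 < n + 8 * (n % 3) →
    (A : List ℕ) → length A + k ≡ d n → Works n A →
    StronglyBounded n A
theorem16 k n 1≤n large A |A|+k≡d (A-unique , positive , n∉⟨A⟩ , below-half , minimal) x x∈A =
  ≰⇒> x-not-small , below-half x x∈A
  where
  open WorkingSet A-unique positive n∉⟨A⟩ below-half minimal x∈A
  x-not-small : ¬ (4 * x ≤ n)
  x-not-small 4x≤n = <⇒≱ large (residue-bound⇒small n k (length A) 1≤n
    (∈-length x∈A) |A|+k≡d
    (≤-trans (*-monoʳ-≤ 4 residue-bound) 4x≤n))
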